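{- Let $F$ be a DeMorgan circuit computing a Boolean function $f:\{0,1\}^n\to\{0,1\}$ with $f(\vec 0)=0$, and let $F^{+}$ be the circuit obtained from $F$ by replacing every negated input literal $\bar x_i$ with the constant $1$. Then $F^{+}$ computes $f^{\uparrow}$ if and only if $F$ impedes zero terms.
   Context: A DeMorgan circuit is a $(\lor,\land)$ circuit (directed acyclic graph, gates of indegree two) whose inputs are the literals $x_1,\dots,x_n,\bar x_1,\dots,\bar x_n$. The upward closure of $f$ is $f^{\uparrow}(x)=\bigvee_{z\leq x}f(z)$. The set $T(F)$ of terms produced by $F$ is defined inductively without using $x\land\bar x=0$: for an input literal $z$, $T(z)=\{z\}$; $T(F_1\lor F_2)=T(F_1)\cup T(F_2)$; $T(F_1\land F_2)=\{t_1\land t_2:t_1\in T(F_1),t_2\in T(F_2)\}$. A zero term is a term containing some variable together with its negation. The positive factor $t^{+}$ of a term $t$ is obtained by replacing each negated literal $\bar x_i$ in $t$ by $1$. $F$ impedes zero terms if $t^{+}\leq f^{\uparrow}$ for every zero term $t\in T(F)$. -}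

module Defs where

open import Data.Nat using (ℕ; zero; suc)
open import Data.Fin using (Fin; zero; suc)
open import Data.Bool using (Bool; true; false; _∧_; _∨_; not) renaming (_≤_ to _≤ᵇ_)
open import Data.List using (List; []; _∷_; _++_; map; concatMap)
open import Data.List.Membership.Propositional using (_∈_)
open import Data.Product using (Σ; _×_; ∃; ∃-syntax; _,_)
open import Data.Sum using (_⊎_; inj₁; inj₂)
open import Relation.Binary.PropositionalEquality using (_≡_)

BVec : ℕ → Set
BVec n = Fin n → Bool

_≤ᵛ_ : ∀ {n} → BVec n → BVec n → Set
z ≤ᵛ x = ∀ i → z i ≤ᵇ x i

0ᵛ : ∀ {n} → BVec n
0ᵛ _ = false

-- upward closure:  f↑(x) = 1  iff  ∃ z ≤ x with f(z) = 1
Up : ∀ {n} → (BVec n → Bool) → BVec n → Set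
Up {n} f x = Σ (BVec n) λ z → (z ≤ᵛ x) × (f z ≡ true)

-- A circuit is a straight-line program (DAG): each new gate is an
-- ∨ or ∧ gate (fan-in two) whose two arguments are wires, i.e. either
-- an input symbol or an earlier gate.  Gate index zero = most recent.

data Op : Set where
  or and : Op

Wire : Set → ℕ → Set
Wire I k = I ⊎ Fin k

data Gates (I : Set) : ℕ → Set where
  []  : Gates I 0
  _▷_ : ∀ {k} → Gates I k → Op × Wire I k × Wire I k → Gates I (suc k)

record Circuit (I : Set) : Set where
  constructor circuit
  field
    size   : ℕ
    gates  : Gates I size
    output : Wire I size

data Formula (I : Set) : Set where
  inp  : I → Formula I
  _∨ᶠ_ : Formula I → Formula I → Formula I
  _∧ᶠ_ : Formula I → Formula I → Formula I

opF : ∀ {I} → Op → Formula I → Formula I → Formula I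
opF or  = _∨ᶠ_
opF and = _∧ᶠ_

unfoldW : ∀ {I k} → Gates I k → Wire I k → Formula I
unfoldW G (inj₁ i) = inp i
unfoldW (G ▷ (o , a , b)) (inj₂ zero) = opF o (unfoldW G a) (unfoldW G b)
unfoldW (G ▷ _) (inj₂ (suc j)) = unfoldW G (inj₂ j)

unfold : ∀ {I} → Circuit I → Formula I
unfold (circuit s G o) = unfoldW G o

mapW : ∀ {I J k} → (I → J) → Wire I k → Wire J k
mapW h (inj₁ i) = inj₁ (h i)
mapW h (inj₂ j) = inj₂ j

mapG : ∀ {I J k} → (I → J) → Gates I k → Gates J k
mapG h [] = []
mapG h (G ▷ (o , a , b)) = mapG h G ▷ (o , mapW h a , mapW h b)

mapC : ∀ {I J} → (I → J) → Circuit I → Circuit J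
mapC h (circuit s G o) = circuit s (mapG h G) (mapW h o)

evalF : ∀ {I} → (I → Bool) → Formula I → Bool
evalF ρ (inp i)  = ρ i
evalF ρ (a ∨ᶠ b) = evalF ρ a ∨ evalF ρ b
evalF ρ (a ∧ᶠ b) = evalF ρ a ∧ evalF ρ b

evalC : ∀ {I} → (I → Bool) → Circuit I → Bool
evalC ρ C = evalF ρ (unfold C)

data Lit (n : ℕ) : Set where
  pos : Fin n → Lit n
  neg : Fin n → Lit n

litVal : ∀ {n} → BVec n → Lit n → Bool
litVal x (pos i) = x i
litVal x (neg i) = not (x i)

DeMorgan : ℕ → Set
DeMorgan n = Circuit (Lit n)

⟦_⟧ : ∀ {n} → DeMorgan n → BVec n → Bool
⟦ F ⟧ x = evalC (litVal x) F

data PlusIn (n : ℕ) : Set where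
  var : Fin n → PlusIn n
  one : PlusIn n

plusLit : ∀ {n} → Lit n → PlusIn n
plusLit (pos i) = var i
plusLit (neg i) = one

plusVal : ∀ {n} → BVec n → PlusIn n → Bool
plusVal x (var i) = x i
plusVal x one     = true

_⁺ : ∀ {n} → DeMorgan n → Circuit (PlusIn n)
F ⁺ = mapC plusLit F

⟦_⟧⁺ : ∀ {n} → Circuit (PlusIn n) → BVec n → Bool
⟦ C ⟧⁺ x = evalC (plusVal x) C

-- Terms produced by a circuit (formal, without using x ∧ x̄ = 0)

Term : ℕ → Set
Term n = List (Lit n)   -- a conjunction of literals

termsF : ∀ {n} → Formula (Lit n) → List (Term n)
termsF (inp l)  = (l ∷ []) ∷ []
termsF (a ∨ᶠ b) = termsF a ++ termsF b
termsF (a ∧ᶠ b) = concatMap (λ t₁ → map (λ t₂ → t₁ ++ t₂) (termsF b)) (termsF a)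

T : ∀ {n} → DeMorgan n → List (Term n)
T F = termsF (unfold F)

ZeroTerm : ∀ {n} → Term n → Set
ZeroTerm {n} t = ∃[ i ] (pos i ∈ t × neg i ∈ t)

termPlus : ∀ {n} → Term n → List (PlusIn n)
termPlus t = map plusLit t

evalConj : ∀ {n} → BVec n → List (PlusIn n) → Bool
evalConj x []       = true
evalConj x (p ∷ ps) = plusVal x p ∧ evalConj x ps

ImpedesZeroTerms : ∀ {n} → DeMorgan n → (BVec n → Bool) → Set
ImpedesZeroTerms {n} F f =
  ∀ (t : Term n) → t ∈ T F → ZeroTerm t →
  ∀ (x : BVec n) → evalConj x (termPlus t) ≡ true → Up f x

{-# OPTIONS --safe #-}
-- F evaluates to 1 exactly where one of its terms is satisfied, and F⁺ exactly where the
-- positive factor of one of its terms is.  A term satisfied at z has its positive factor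
-- true at every x ≥ z, so F⁺ ≥ f↑ always.  Conversely, if t⁺(x) = 1 for a term t that is
-- not a zero term, then t itself is satisfied at the point z ≤ x that is 1 exactly on the
-- positive literals of t, so f↑(x) = 1.  Hence F⁺ ≤ f↑ fails only through zero terms.
module Submission where

open import Defs
open import Data.Nat using (ℕ)
open import Data.Bool using (Bool; true; false; _∧_; _∨_; not; b≤b) renaming (_≤_ to _≤ᵇ_)
open import Data.Bool.Properties using (∧-conicalˡ; ∧-conicalʳ; ≤-minimum)
open import Data.Fin using (zero; suc)
open import Data.Fin.Properties using (_≟_; any?)
open import Data.List using (List; []; _∷_; _++_; map; concatMap; cartesianProductWith)
open import Data.List.Relation.Unary.All as All using (All; []; _∷_)
open import Data.List.Relation.Unary.All.Properties using (++⁺; ++⁻ˡ; ++⁻ʳ; map⁺; map⁻)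
open import Data.List.Relation.Unary.Any using (here)
open import Data.List.Membership.Propositional using (_∈_)
open import Data.List.Membership.Propositional.Properties
  using (∈-++⁺ˡ; ∈-++⁺ʳ; ∈-++⁻; ∈-cartesianProductWith⁺; ∈-cartesianProductWith⁻)
open import Data.Product using (_×_; ∃-syntax; _,_)
open import Data.Sum using (_⊎_; inj₁; inj₂)
open import Function using (_∘_)
open import Function.Bundles using (_⇔_; mk⇔; Equivalence)
open import Relation.Nullary using (Dec; yes; no; ¬_)
open import Relation.Nullary.Decidable using (does; dec-true; dec-false; map′; _×-dec_)
open import Relation.Binary.Definitions using (DecidableEquality)
open import Relation.Binary.PropositionalEquality using (_≡_; refl; sym; trans; cong; cong₂; subst)

private
  variable
    I J : Set
    n k : ℕ

∧≡true⇔ : ∀ {a b} → a ∧ b ≡ true ⇔ (a ≡ true × b ≡ true)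
∧≡true⇔ {a} {b} = mk⇔ (λ p → ∧-conicalˡ a b p , ∧-conicalʳ a b p) λ { (refl , refl) → refl }

∨≡true⇔ : ∀ {a b} → a ∨ b ≡ true ⇔ (a ≡ true ⊎ b ≡ true)
∨≡true⇔ {true}  = mk⇔ (λ _ → inj₁ refl) (λ _ → refl)
∨≡true⇔ {false} = mk⇔ inj₂ λ { (inj₁ ()) ; (inj₂ p) → p }

true≤⇒≡true : ∀ {b} → true ≤ᵇ b → b ≡ true
true≤⇒≡true b≤b = refl

concatMap-map≡cartesianProductWith : ∀ {A B C : Set} (f : A → B → C) xs ys →
  concatMap (λ x → map (f x) ys) xs ≡ cartesianProductWith f xs ys
concatMap-map≡cartesianProductWith f []       ys = refl
concatMap-map≡cartesianProductWith f (x ∷ xs) ys =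
  cong (map (f x) ys ++_) (concatMap-map≡cartesianProductWith f xs ys)

evalF-unfoldW-mapG : (h : I → J) (ρ : J → Bool) (G : Gates I k) (w : Wire I k) →
  evalF ρ (unfoldW (mapG h G) (mapW h w)) ≡ evalF (ρ ∘ h) (unfoldW G w)
evalF-unfoldW-mapG h ρ G (inj₁ i) = refl
evalF-unfoldW-mapG h ρ (G ▷ (or , a , b)) (inj₂ zero) =
  cong₂ _∨_ (evalF-unfoldW-mapG h ρ G a) (evalF-unfoldW-mapG h ρ G b)
evalF-unfoldW-mapG h ρ (G ▷ (and , a , b)) (inj₂ zero) =
  cong₂ _∧_ (evalF-unfoldW-mapG h ρ G a) (evalF-unfoldW-mapG h ρ G b)
evalF-unfoldW-mapG h ρ (G ▷ _) (inj₂ (suc j)) = evalF-unfoldW-mapG h ρ G (inj₂ j)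

evalC-mapC : (h : I → J) (ρ : J → Bool) (C : Circuit I) → evalC ρ (mapC h C) ≡ evalC (ρ ∘ h) C
evalC-mapC h ρ (circuit s G o) = evalF-unfoldW-mapG h ρ G o

Satisfies : (I → Bool) → List I → Set
Satisfies ρ t = All (λ l → ρ l ≡ true) t

termsF-sound : (ρ : Lit n → Bool) (φ : Formula (Lit n)) {t : Term n} →
  t ∈ termsF φ → Satisfies ρ t → evalF ρ φ ≡ true
termsF-sound ρ (inp l) (here refl) (p ∷ []) = p
termsF-sound ρ (a ∨ᶠ b) t∈ sat with ∈-++⁻ (termsF a) t∈
... | inj₁ t∈a = Equivalence.from ∨≡true⇔ (inj₁ (termsF-sound ρ a t∈a sat))
... | inj₂ t∈b = Equivalence.from ∨≡true⇔ (inj₂ (termsF-sound ρ b t∈b sat))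
termsF-sound ρ (a ∧ᶠ b) t∈ sat
  with ∈-cartesianProductWith⁻ _++_ (termsF a) (termsF b)
         (subst (_ ∈_) (concatMap-map≡cartesianProductWith _++_ (termsF a) (termsF b)) t∈)
... | t₁ , t₂ , t₁∈ , t₂∈ , refl = Equivalence.from ∧≡true⇔
  (termsF-sound ρ a t₁∈ (++⁻ˡ t₁ sat) , termsF-sound ρ b t₂∈ (++⁻ʳ t₁ sat))

termsF-complete : (ρ : Lit n → Bool) (φ : Formula (Lit n)) →
  evalF ρ φ ≡ true → ∃[ t ] (t ∈ termsF φ × Satisfies ρ t)
termsF-complete ρ (inp l) p = l ∷ [] , here refl , p ∷ []
termsF-complete ρ (a ∨ᶠ b) p with Equivalence.to ∨≡true⇔ p
... | inj₁ pa = let t , t∈ , sat = termsF-complete ρ a pa in t , ∈-++⁺ˡ t∈ , sat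
... | inj₂ pb = let t , t∈ , sat = termsF-complete ρ b pb in t , ∈-++⁺ʳ (termsF a) t∈ , sat
termsF-complete ρ (a ∧ᶠ b) p =
  let pa , pb = Equivalence.to ∧≡true⇔ p
      t₁ , t₁∈ , sat₁ = termsF-complete ρ a pa
      t₂ , t₂∈ , sat₂ = termsF-complete ρ b pb
  in t₁ ++ t₂
   , subst (t₁ ++ t₂ ∈_) (sym (concatMap-map≡cartesianProductWith _++_ (termsF a) (termsF b)))
       (∈-cartesianProductWith⁺ _++_ t₁∈ t₂∈)
   , ++⁺ sat₁ sat₂

litVal⁺ : BVec n → Lit n → Bool
litVal⁺ x = plusVal x ∘ plusLit

⟦⁺⟧≡evalF-litVal⁺ : (F : DeMorgan n) (x : BVec n) → ⟦ F ⁺ ⟧⁺ x ≡ evalF (litVal⁺ x) (unfold F)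
⟦⁺⟧≡evalF-litVal⁺ F x = evalC-mapC plusLit (plusVal x) F

evalConj≡true⇔ : (x : BVec n) (ps : List (PlusIn n)) →
  evalConj x ps ≡ true ⇔ Satisfies (plusVal x) ps
evalConj≡true⇔ x []       = mk⇔ (λ _ → []) (λ _ → refl)
evalConj≡true⇔ x (p ∷ ps) = mk⇔
  (λ e → let e₁ , e₂ = Equivalence.to ∧≡true⇔ e in e₁ ∷ Equivalence.to (evalConj≡true⇔ x ps) e₂)
  (λ { (s ∷ ss) → Equivalence.from ∧≡true⇔ (s , Equivalence.from (evalConj≡true⇔ x ps) ss) })

termPlus≡true⇔ : (x : BVec n) (t : Term n) →
  evalConj x (termPlus t) ≡ true ⇔ Satisfies (litVal⁺ x) t
termPlus≡true⇔ x t = mk⇔ (map⁻ ∘ Equivalence.to (evalConj≡true⇔ x (termPlus t)))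
                         (Equivalence.from (evalConj≡true⇔ x (termPlus t)) ∘ map⁺)

litVal-≤⇒litVal⁺ : {z x : BVec n} → z ≤ᵛ x → (l : Lit n) → litVal z l ≡ true → litVal⁺ x l ≡ true
litVal-≤⇒litVal⁺ {x = x} z≤x (pos i) zᵢ = true≤⇒≡true (subst (_≤ᵇ x i) zᵢ (z≤x i))
litVal-≤⇒litVal⁺         z≤x (neg i) _  = refl

_≟ˡ_ : DecidableEquality (Lit n)
pos i ≟ˡ pos j = map′ (cong pos) (λ { refl → refl }) (i ≟ j)
neg i ≟ˡ neg j = map′ (cong neg) (λ { refl → refl }) (i ≟ j)
pos i ≟ˡ neg j = no λ ()
neg i ≟ˡ pos j = no λ ()

module _ {n : ℕ} where
  open import Data.List.Membership.DecPropositional (_≟ˡ_ {n}) using (_∈?_)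

  zeroTerm? : (t : Term n) → Dec (ZeroTerm t)
  zeroTerm? t = any? λ i → pos i ∈? t ×-dec neg i ∈? t

  lowest : Term n → BVec n
  lowest t i = does (pos i ∈? t)

  lowest-satisfies : (t : Term n) → ¬ ZeroTerm t → Satisfies (litVal (lowest t)) t
  lowest-satisfies t t≢0 = All.tabulate satisfied
    where
    satisfied : ∀ {l} → l ∈ t → litVal (lowest t) l ≡ true
    satisfied {pos i} pos∈ = dec-true (pos i ∈? t) pos∈
    satisfied {neg i} neg∈ = cong not (dec-false (pos i ∈? t) λ pos∈ → t≢0 (i , pos∈ , neg∈))

  lowest-≤ : (t : Term n) {x : BVec n} → Satisfies (litVal⁺ x) t → lowest t ≤ᵛ x
  lowest-≤ t {x} sat i with pos i ∈? t
  ... | yes pos∈ = subst (true ≤ᵇ_) (sym (All.lookup sat pos∈)) b≤b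
  ... | no _     = ≤-minimum (x i)

module _ {n : ℕ} (F : DeMorgan n) where

  ⟦⁺⟧-sound : ∀ {t x} → t ∈ T F → Satisfies (litVal⁺ x) t → ⟦ F ⁺ ⟧⁺ x ≡ true
  ⟦⁺⟧-sound {x = x} t∈ sat = trans (⟦⁺⟧≡evalF-litVal⁺ F x) (termsF-sound (litVal⁺ x) (unfold F) t∈ sat)

  ⟦⁺⟧-complete : ∀ x → ⟦ F ⁺ ⟧⁺ x ≡ true → ∃[ t ] (t ∈ T F × Satisfies (litVal⁺ x) t)
  ⟦⁺⟧-complete x F⁺x = termsF-complete (litVal⁺ x) (unfold F) (trans (sym (⟦⁺⟧≡evalF-litVal⁺ F x)) F⁺x)

  module _ {f : BVec n → Bool} (F≗f : ∀ x → ⟦ F ⟧ x ≡ f x) where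

    Up⇒⟦⁺⟧ : ∀ x → Up f x → ⟦ F ⁺ ⟧⁺ x ≡ true
    Up⇒⟦⁺⟧ x (z , z≤x , fz) =
      let t , t∈ , sat = termsF-complete (litVal z) (unfold F) (trans (F≗f z) fz)
      in ⟦⁺⟧-sound t∈ (All.map (λ {l} → litVal-≤⇒litVal⁺ z≤x l) sat)

    nonZeroTerm⇒Up : ∀ {t} x → t ∈ T F → ¬ ZeroTerm t → Satisfies (litVal⁺ x) t → Up f x
    nonZeroTerm⇒Up {t} x t∈ t≢0 sat =
      lowest t , lowest-≤ t sat ,
      trans (sym (F≗f (lowest t))) (termsF-sound _ (unfold F) t∈ (lowest-satisfies t t≢0))

fact4 : ∀ (n : ℕ) (F : DeMorgan n) (f : BVec n → Bool) →
          (∀ x → ⟦ F ⟧ x ≡ f x) → f 0ᵛ ≡ false →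
          ((∀ x → (⟦ F ⁺ ⟧⁺ x ≡ true) ⇔ Up f x) ⇔ ImpedesZeroTerms F f)
fact4 n F f F≗f _ = mk⇔ computes⇒impedes impedes⇒computes
  where
  computes⇒impedes : (∀ x → (⟦ F ⁺ ⟧⁺ x ≡ true) ⇔ Up f x) → ImpedesZeroTerms F f
  computes⇒impedes F⁺≗f↑ t t∈ _ x t⁺x =
    Equivalence.to (F⁺≗f↑ x) (⟦⁺⟧-sound F t∈ (Equivalence.to (termPlus≡true⇔ x t) t⁺x))

  impedes⇒computes : ImpedesZeroTerms F f → ∀ x → (⟦ F ⁺ ⟧⁺ x ≡ true) ⇔ Up f x
  impedes⇒computes impedes x = mk⇔ ⟦⁺⟧⇒Up (Up⇒⟦⁺⟧ F F≗f x)
    where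
    ⟦⁺⟧⇒Up : ⟦ F ⁺ ⟧⁺ x ≡ true → Up f x
    ⟦⁺⟧⇒Up F⁺x with ⟦⁺⟧-complete F x F⁺x
    ... | t , t∈ , sat with zeroTerm? t
    ...   | yes t≡0 = impedes t t∈ t≡0 x (Equivalence.from (termPlus≡true⇔ x t) sat)
    ...   | no t≢0  = nonZeroTerm⇒Up F F≗f x t∈ t≢0 sat
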